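{- Let $\mathcal{C},\mathcal{D}$ be labeled configurations on $\mathbb{Z}$ with $\mathcal{C}\to\mathcal{D}$, and let $k\in\mathbb{N}$. Then $[\mathcal{C}|_{\geq k}]\xrightarrow{R}[\mathcal{D}|_{\geq k}]$.
   Context: Labeled chip-firing on $\mathbb{Z}$: a labeled configuration is $\mathcal{C}\colon X\to\mathbb{Z}$, $X\subseteq\mathbb{Z}_{>0}$ finite, chip $(i)$ at vertex $\mathcal{C}(i)$; a move fires chips $(a),(b)$ with $a<b$ at a common vertex $i$, sending $(a)$ to $i-1$ and $(b)$ to $i+1$; $\mathcal{C}\to\mathcal{D}$ means reachable by zero or more moves. $\mathcal{C}|_{\geq k}$ is the restriction of $\mathcal{C}$ to the chips with labels $\geq k$. $[\mathcal{C}]$ is the underlying unlabeled configuration, $[\mathcal{C}](i)=\#\mathcal{C}^{ -1}(i)$. For unlabeled configurations $c,d\colon\mathbb{Z}\to\mathbb{N}$ (finite total), $c\xrightarrow{R}d$ (rightward-reachable) means $d$ is obtained from $c$ by a sequence of zero or more moves each of which is either an (unlabeled) chip-firing move (if $c(i)\geq2$, move one chip from $i$ to $i-1$ and one to $i+1$) or moving a single chip one vertex to the right. -}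

module Defs where

open import Data.Nat using (ℕ; zero; suc; _<_; _≥_; _≤?_)
open import Data.Integer as ℤ using (ℤ; _+_; _-_; 1ℤ)
open import Data.Maybe using (Maybe; just; nothing)
open import Data.Maybe.Properties using (≡-dec)
open import Data.Product using (Σ; ∃; _×_; _,_)
open import Data.Sum using (_⊎_)
open import Relation.Nullary using (yes; no; ¬_)
open import Relation.Binary.PropositionalEquality using (_≡_)

-- A labeled configuration C : X → ℤ (X ⊆ ℤ_{>0} finite) is encoded as a
-- partial map ℕ → Maybe ℤ : label j ∈ X  iff  map j ≡ just (position of chip (j)).
LMap : Set
LMap = ℕ → Maybe ℤ

record LConfig : Set where
  field
    map      : LMap
    bound    : ℕ
    positive : map 0 ≡ nothing
    finite   : ∀ j → j ≥ bound → map j ≡ nothing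
open LConfig public

data LMove (C D : LMap) : Set where
  fire : (a b : ℕ) (i : ℤ) → a < b →
         C a ≡ just i → C b ≡ just i →
         D a ≡ just (i - 1ℤ) → D b ≡ just (i + 1ℤ) →
         (∀ j → ¬ j ≡ a → ¬ j ≡ b → D j ≡ C j) →
         LMove C D

data _⟶*_ (C D : LMap) : Set where
  done : (∀ j → C j ≡ D j) → C ⟶* D
  step : (E : LMap) → LMove C E → E ⟶* D → C ⟶* D

restrict : ℕ → LMap → LMap
restrict k f j with k ≤? j
... | yes _ = f j
... | no  _ = nothing

count : ℕ → LMap → ℤ → ℕ
count zero    f i = 0
count (suc n) f i with ≡-dec ℤ._≟_ (f n) (just i)
... | yes _ = suc (count n f i)
... | no  _ = count n f i

UConfig : Set
UConfig = ℤ → ℕ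

underlying : ℕ → LMap → UConfig
underlying N f = count N f

underlyingRestrict : LConfig → ℕ → UConfig
underlyingRestrict C k = underlying (bound C) (restrict k (map C))

data RMove (c d : UConfig) : Set where
  fireU : (i : ℤ) → (n : ℕ) → c i ≡ suc (suc n) → d i ≡ n →
          d (i - 1ℤ) ≡ suc (c (i - 1ℤ)) → d (i + 1ℤ) ≡ suc (c (i + 1ℤ)) →
          (∀ j → ¬ j ≡ i → ¬ j ≡ i - 1ℤ → ¬ j ≡ i + 1ℤ → d j ≡ c j) →
          RMove c d
  right : (i : ℤ) → (n : ℕ) → c i ≡ suc n → d i ≡ n →
          d (i + 1ℤ) ≡ suc (c (i + 1ℤ)) →
          (∀ j → ¬ j ≡ i → ¬ j ≡ i + 1ℤ → d j ≡ c j) →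
          RMove c d

data _⟶R_ (c d : UConfig) : Set where
  doneR : (∀ i → c i ≡ d i) → c ⟶R d
  stepR : (e : UConfig) → RMove c e → e ⟶R d → c ⟶R d

-- Since the two chips of a move satisfy a < b and the smaller one goes left, deleting the
-- chips with labels < k turns a move into an unlabeled firing (k ≤ a), a single chip stepping
-- right (a < k ≤ b), or nothing at all (b < k).
module Submission where

open import Defs
open import Data.Nat as ℕ using (ℕ; zero; suc; _≤_; _<_; _≤?_)
import Data.Nat.Properties as ℕ
open import Data.Integer as ℤ using (ℤ; 1ℤ)
import Data.Integer.Properties as ℤ
open import Data.Maybe using (Maybe; just; nothing)
open import Data.Maybe.Properties using (≡-dec; just-injective)
open import Function using (_∘_)
open import Relation.Nullary using (Dec; yes; no)
open import Relation.Nullary.Negation using (contradiction)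
open import Relation.Binary.PropositionalEquality

private variable
  f g : LMap
  a b j k m n N M : ℕ
  i x y : ℤ
  c c′ d d′ e : UConfig

i-1<i : i ℤ.- 1ℤ ℤ.< i
i-1<i {i} = subst (i ℤ.- 1ℤ ℤ.<_) (ℤ.+-identityʳ i) (ℤ.+-monoʳ-< i ℤ.-<+)

i<i+1 : i ℤ.< i ℤ.+ 1ℤ
i<i+1 {i} = subst (ℤ._< i ℤ.+ 1ℤ) (ℤ.+-identityʳ i) (ℤ.+-monoʳ-< i (ℤ.+<+ ℕ.z<s))

just-≢ : {m : Maybe ℤ} → m ≡ just x → x ≢ y → m ≢ just y
just-≢ refl x≢y = x≢y ∘ just-injective

count-hit : ∀ n f → f n ≡ just i → count (suc n) f i ≡ suc (count n f i)
count-hit {i = i} n f hit with ≡-dec ℤ._≟_ (f n) (just i)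
... | yes _   = refl
... | no miss = contradiction hit miss

count-miss : ∀ n f → f n ≢ just i → count (suc n) f i ≡ count n f i
count-miss {i = i} n f miss with ≡-dec ℤ._≟_ (f n) (just i)
... | yes hit = contradiction hit miss
... | no _    = refl

count-suc-cong : ∀ n f g → f n ≡ g n → count n f i ≡ m ℕ.+ count n g i →
                 count (suc n) f i ≡ m ℕ.+ count (suc n) g i
count-suc-cong {i = i} {m = m} n f g fn≡gn eq = by-cases (≡-dec ℤ._≟_ (f n) (just i))
  where
  open ≡-Reasoning
  by-cases : Dec (f n ≡ just i) → count (suc n) f i ≡ m ℕ.+ count (suc n) g i
  by-cases (yes hit) = begin
    count (suc n) f i        ≡⟨ count-hit n f hit ⟩
    suc (count n f i)        ≡⟨ cong suc eq ⟩
    suc (m ℕ.+ count n g i)  ≡⟨ ℕ.+-suc m _ ⟨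
    m ℕ.+ suc (count n g i)  ≡⟨ cong (m ℕ.+_) (count-hit n g (trans (sym fn≡gn) hit)) ⟨
    m ℕ.+ count (suc n) g i  ∎
  by-cases (no miss) = begin
    count (suc n) f i        ≡⟨ count-miss n f miss ⟩
    count n f i              ≡⟨ eq ⟩
    m ℕ.+ count n g i        ≡⟨ cong (m ℕ.+_) (count-miss n g (miss ∘ trans fn≡gn)) ⟨
    m ℕ.+ count (suc n) g i  ∎

count-cong : (∀ j → j < n → f j ≡ g j) → count n f i ≡ count n g i
count-cong {n = zero} _ = refl
count-cong {n = suc n} {f = f} {g = g} f≗g =
  count-suc-cong {m = 0} n f g (f≗g n ℕ.≤-refl) (count-cong λ j j<n → f≗g j (ℕ.m≤n⇒m≤1+n j<n))

_≗_except_ : LMap → LMap → ℕ → Set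
f ≗ g except a = ∀ j → j ≢ a → f j ≡ g j

≗-except-sym : f ≗ g except a → g ≗ f except a
≗-except-sym f≗g j j≢a = sym (f≗g j j≢a)

count-update-miss : ∀ n → f ≗ g except a → f a ≢ just i → g a ≢ just i → count n f i ≡ count n g i
count-update-miss zero _ _ _ = refl
count-update-miss {f = f} {g = g} {a = a} (suc n) f≗g fa-miss ga-miss with n ℕ.≟ a
... | yes refl = trans (count-miss n f fa-miss)
                       (trans (count-update-miss n f≗g fa-miss ga-miss) (sym (count-miss n g ga-miss)))
... | no n≢a   = count-suc-cong {m = 0} n f g (f≗g n n≢a) (count-update-miss n f≗g fa-miss ga-miss)

count-update-hit : a < n → f ≗ g except a → f a ≡ just i → g a ≢ just i →
                   count n f i ≡ suc (count n g i)
count-update-hit {a = a} {n = suc n} {f = f} {g = g} a<1+n f≗g fa-hit ga-miss with n ℕ.≟ a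
... | yes refl = trans (count-hit n f fa-hit)
                       (cong suc (trans (count-cong {n = n} λ j j<n → f≗g j (ℕ.<⇒≢ j<n))
                                        (sym (count-miss n g ga-miss))))
... | no n≢a   = count-suc-cong {m = 1} n f g (f≗g n n≢a)
                   (count-update-hit (ℕ.≤∧≢⇒< (ℕ.s≤s⁻¹ a<1+n) (n≢a ∘ sym)) f≗g fa-hit ga-miss)

Bounded : LMap → ℕ → Set
Bounded f N = ∀ j → N ≤ j → f j ≡ nothing

bounded-just⇒< : Bounded f N → f j ≡ just x → j < N
bounded-just⇒< {N = N} {j = j} bd fj with j ℕ.<? N
... | yes j<N = j<N
... | no  j≮N = contradiction (trans (sym fj) (bd j (ℕ.≮⇒≥ j≮N))) λ ()

count-pad : Bounded f N → ∀ d → count (d ℕ.+ N) f i ≡ count N f i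
count-pad bd zero    = refl
count-pad {f = f} {N = N} bd (suc d) =
  trans (count-miss (d ℕ.+ N) f λ hit → contradiction (trans (sym hit) (bd _ (ℕ.m≤n+m N d))) λ ())
        (count-pad bd d)

count-stable : Bounded f N → Bounded f M → count N f i ≡ count M f i
count-stable {f = f} {N = N} {M = M} {i = i} bdN bdM = begin
  count N f i          ≡⟨ count-pad bdN M ⟨
  count (M ℕ.+ N) f i  ≡⟨ cong (λ n → count n f i) (ℕ.+-comm M N) ⟩
  count (N ℕ.+ M) f i  ≡⟨ count-pad bdM N ⟩
  count M f i          ∎
  where open ≡-Reasoning

bounded-move : Bounded f N → LMove f g → Bounded g N
bounded-move {f = f} bd (fire a b _ _ fa fb _ _ g≗f) j N≤j =
  trans (g≗f j (outside fa) (outside fb)) (bd j N≤j)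
  where outside : ∀ {l x} → f l ≡ just x → j ≢ l
        outside fl refl = ℕ.<⇒≱ (bounded-just⇒< bd fl) N≤j

bounded-⟶* : Bounded f N → f ⟶* g → Bounded g N
bounded-⟶* bd (done f≗g)   j N≤j = trans (sym (f≗g j)) (bd j N≤j)
bounded-⟶* bd (step _ mv r)      = bounded-⟶* (bounded-move bd mv) r

_[_]≔_ : LMap → ℕ → Maybe ℤ → LMap
(f [ a ]≔ v) j with j ℕ.≟ a
... | yes _ = v
... | no  _ = f j

update-≡ : ∀ f a {v} → (f [ a ]≔ v) a ≡ v
update-≡ f a with a ℕ.≟ a
... | yes _   = refl
... | no  a≢a = contradiction refl a≢a

update-≢ : ∀ {v} → j ≢ a → (f [ a ]≔ v) j ≡ f j
update-≢ {j = j} {a = a} j≢a with j ℕ.≟ a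
... | yes j≡a = contradiction j≡a j≢a
... | no  _   = refl

count-shift : b < N → f ≗ g except b → f b ≡ just i → g b ≡ just (i ℤ.+ 1ℤ) →
              RMove (count N f) (count N g)
count-shift {N = N} b<N f≗g fb gb = right _ _
  (count-update-hit b<N f≗g fb (just-≢ gb (ℤ.<⇒≢ i<i+1 ∘ sym)))
  refl
  (count-update-hit b<N (≗-except-sym f≗g) gb (just-≢ fb (ℤ.<⇒≢ i<i+1)))
  λ j j≢i j≢i+1 → sym (count-update-miss N f≗g (just-≢ fb (j≢i ∘ sym)) (just-≢ gb (j≢i+1 ∘ sym)))

count-fire : a < N → b < N → a ≢ b → (∀ j → j ≢ a → j ≢ b → f j ≡ g j) →
             f a ≡ just i → f b ≡ just i → g a ≡ just (i ℤ.- 1ℤ) → g b ≡ just (i ℤ.+ 1ℤ) →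
             RMove (count N f) (count N g)
count-fire {a = a} {N = N} {b = b} {f = f} {g = g} {i = i} a<N b<N a≢b f≗g fa fb ga gb =
  fireU i _ at-i refl at-i-1 at-i+1 elsewhere
  where
  h : LMap
  h = f [ a ]≔ g a

  f≗h : f ≗ h except a
  f≗h j j≢a = sym (update-≢ {f = f} j≢a)

  h≗g : h ≗ g except b
  h≗g j j≢b = by-cases (j ℕ.≟ a)
    where
    by-cases : Dec (j ≡ a) → h j ≡ g j
    by-cases (yes j≡a) = subst (λ l → h l ≡ g l) (sym j≡a) (update-≡ f a)
    by-cases (no  j≢a) = trans (update-≢ {f = f} j≢a) (f≗g j j≢a j≢b)

  ha : h a ≡ just (i ℤ.- 1ℤ)
  ha = trans (update-≡ f a) ga

  hb : h b ≡ just i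
  hb = trans (update-≢ {f = f} (a≢b ∘ sym)) fb

  i-1≢i : i ℤ.- 1ℤ ≢ i
  i-1≢i = ℤ.<⇒≢ i-1<i

  i≢i+1 : i ≢ i ℤ.+ 1ℤ
  i≢i+1 = ℤ.<⇒≢ i<i+1

  i-1≢i+1 : i ℤ.- 1ℤ ≢ i ℤ.+ 1ℤ
  i-1≢i+1 = ℤ.<⇒≢ (ℤ.<-trans i-1<i (i<i+1 {i = i}))

  at-i : count N f i ≡ suc (suc (count N g i))
  at-i = trans (count-update-hit a<N f≗h fa (just-≢ ha i-1≢i))
               (cong suc (count-update-hit b<N h≗g hb (just-≢ gb (i≢i+1 ∘ sym))))

  at-i-1 : count N g (i ℤ.- 1ℤ) ≡ suc (count N f (i ℤ.- 1ℤ))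
  at-i-1 = trans (sym (count-update-miss N h≗g (just-≢ hb (i-1≢i ∘ sym)) (just-≢ gb (i-1≢i+1 ∘ sym))))
                 (count-update-hit a<N (≗-except-sym f≗h) ha (just-≢ fa (i-1≢i ∘ sym)))

  at-i+1 : count N g (i ℤ.+ 1ℤ) ≡ suc (count N f (i ℤ.+ 1ℤ))
  at-i+1 = trans (count-update-hit b<N (≗-except-sym h≗g) gb (just-≢ hb i≢i+1))
                 (cong suc (sym (count-update-miss N f≗h (just-≢ fa i≢i+1) (just-≢ ha i-1≢i+1))))

  elsewhere : ∀ j → j ≢ i → j ≢ i ℤ.- 1ℤ → j ≢ i ℤ.+ 1ℤ → count N g j ≡ count N f j
  elsewhere j j≢i j≢i-1 j≢i+1 = sym (trans
    (count-update-miss N f≗h (just-≢ fa (j≢i ∘ sym)) (just-≢ ha (j≢i-1 ∘ sym)))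
    (count-update-miss N h≗g (just-≢ hb (j≢i ∘ sym)) (just-≢ gb (j≢i+1 ∘ sym))))

RMove-respˡ : (∀ i → c i ≡ c′ i) → RMove c′ d → RMove c d
RMove-respˡ c≗c′ (fireU i n ci di dl dr rest) =
  fireU i n (trans (c≗c′ i) ci) di (trans dl (cong suc (sym (c≗c′ _))))
        (trans dr (cong suc (sym (c≗c′ _)))) (λ j p q r → trans (rest j p q r) (sym (c≗c′ j)))
RMove-respˡ c≗c′ (right i n ci di dr rest) =
  right i n (trans (c≗c′ i) ci) di (trans dr (cong suc (sym (c≗c′ _))))
        (λ j p q → trans (rest j p q) (sym (c≗c′ j)))

⟶R-respˡ : (∀ i → c i ≡ c′ i) → c′ ⟶R d → c ⟶R d
⟶R-respˡ c≗c′ (doneR c′≗d)    = doneR λ i → trans (c≗c′ i) (c′≗d i)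
⟶R-respˡ c≗c′ (stepR _ mv r) = stepR _ (RMove-respˡ c≗c′ mv) r

⟶R-respʳ : c ⟶R d → (∀ i → d i ≡ d′ i) → c ⟶R d′
⟶R-respʳ (doneR c≗d)    d≗d′ = doneR λ i → trans (c≗d i) (d≗d′ i)
⟶R-respʳ (stepR _ mv r) d≗d′ = stepR _ mv (⟶R-respʳ r d≗d′)

⟶R-trans : c ⟶R d → d ⟶R e → c ⟶R e
⟶R-trans (doneR c≗d)    r′ = ⟶R-respˡ c≗d r′
⟶R-trans (stepR _ mv r) r′ = stepR _ mv (⟶R-trans r r′)

RMove⇒⟶R : RMove c d → c ⟶R d
RMove⇒⟶R mv = stepR _ mv (doneR λ _ → refl)

restrict-≥ : k ≤ j → restrict k f j ≡ f j
restrict-≥ {k = k} {j = j} k≤j with k ≤? j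
... | yes _   = refl
... | no  k≰j = contradiction k≤j k≰j

restrict-cong : (k ≤ j → f j ≡ g j) → restrict k f j ≡ restrict k g j
restrict-cong {k = k} {j = j} eq with k ≤? j
... | yes k≤j = eq k≤j
... | no  _   = refl

count-restrict-cong : (∀ j → k ≤ j → f j ≡ g j) → count n (restrict k f) i ≡ count n (restrict k g) i
count-restrict-cong {k = k} {f = f} {g = g} {n = n} f≗g =
  count-cong {n = n} λ j _ → restrict-cong {k = k} {j = j} {f = f} {g = g} (f≗g j)

restrict-bounded : ∀ k → Bounded f N → Bounded (restrict k f) N
restrict-bounded k bd j N≤j with k ≤? j
... | yes _ = bd j N≤j
... | no  _ = refl

restrict-move : ∀ k → Bounded f N → LMove f g → count N (restrict k f) ⟶R count N (restrict k g)
restrict-move {f = f} {N = N} {g = g} k bd (fire a b i a<b fa fb ga gb g≗f) with k ≤? a | k ≤? b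
... | yes k≤a | _ =
  RMove⇒⟶R (count-fire {f = restrict k f} {g = restrict k g}
    (bounded-just⇒< bd fa) (bounded-just⇒< bd fb) (ℕ.<⇒≢ a<b)
    (λ j j≢a j≢b → restrict-cong {k = k} λ _ → sym (g≗f j j≢a j≢b))
    (trans (restrict-≥ k≤a) fa) (trans (restrict-≥ k≤b) fb)
    (trans (restrict-≥ k≤a) ga) (trans (restrict-≥ k≤b) gb))
  where k≤b = ℕ.≤-trans k≤a (ℕ.<⇒≤ a<b)
... | no k≰a | yes k≤b =
  RMove⇒⟶R (count-shift {f = restrict k f} {g = restrict k g} (bounded-just⇒< bd fb)
    (λ j j≢b → restrict-cong {k = k} λ k≤j → sym (g≗f j (λ { refl → k≰a k≤j }) j≢b))
    (trans (restrict-≥ k≤b) fb) (trans (restrict-≥ k≤b) gb))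
... | no k≰a | no k≰b = doneR λ _ → count-restrict-cong {k = k} {n = N} λ j k≤j →
  sym (g≗f j (λ { refl → k≰a k≤j }) (λ { refl → k≰b k≤j }))

restrict-⟶R : ∀ k → Bounded f N → f ⟶* g → count N (restrict k f) ⟶R count N (restrict k g)
restrict-⟶R {N = N} k bd (done f≗g)   = doneR λ _ → count-restrict-cong {k = k} {n = N} λ j _ → f≗g j
restrict-⟶R           k bd (step _ mv r) =
  ⟶R-trans (restrict-move k bd mv) (restrict-⟶R k (bounded-move bd mv) r)

proposition2p9 : (C D : LConfig) (k : ℕ) → map C ⟶* map D →
    underlyingRestrict C k ⟶R underlyingRestrict D k
proposition2p9 C D k C⟶D = ⟶R-respʳ (restrict-⟶R k (finite C) C⟶D) λ _ →
  count-stable (restrict-bounded k (bounded-⟶* (finite C) C⟶D)) (restrict-bounded k (finite D))
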